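{- Let $n\ge 6$ and let $f:E(K_n)\to\{ -1,1\}$ be such that $\min\{e(-1),e(1)\}\ge\lceil\frac{n+1}{2}\rceil$. Then for every two distinct vertices $x$ and $y$ of $K_n$ there is a path $P$ of length at most $4$ with end vertices $x$ and $y$ such that $f(P)=0$. Furthermore, the lower bound is sharp: for every $n\ge 6$ there is a colouring $f:E(K_n)\to\{ -1,1\}$ with $\min\{e(-1),e(1)\}=\lceil\frac{n+1}{2}\rceil-1$ and two distinct vertices $a,b$ such that no path $P$ of length at most $4$ with end vertices $a$ and $b$ has $f(P)=0$.
   Context: For $f:E(K_n)\to\{ -1,1\}$ and a subgraph $H$, $f(H)=\sum_{e\in E(H)}f(e)$; $e(-1)$ and $e(1)$ denote the numbers of edges coloured $-1$ and $1$ respectively. The length of a path is its number of edges. -}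

module Defs where

open import Data.Nat using (ℕ; zero; suc; _+_; _<ᵇ_)
open import Data.Integer using (ℤ; 0ℤ; 1ℤ; -1ℤ) renaming (_+_ to _+ℤ_)
open import Data.Bool using (Bool; true; false; if_then_else_; _∧_)
open import Data.Fin using (Fin; toℕ)
open import Data.List using (List; []; _∷_; _++_; length; map; allFin)
open import Data.Nat.ListAction using (sum)
open import Data.Sign using (Sign) renaming (- to minus; + to plus)
import Data.Sign.Properties as SignP
open import Relation.Nullary.Decidable using (⌊_⌋)
open import Relation.Binary.PropositionalEquality using (_≡_)

-- Values on the
-- diagonal (i = i) are irrelevant: they are never counted nor used.
record Colouring (n : ℕ) : Set where
  field
    col  : Fin n → Fin n → Sign
    symm : ∀ i j → col i j ≡ col j i
open Colouring public

val : Sign → ℤ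
val minus = -1ℤ
val plus  = 1ℤ

edgeCount : ∀ {n} → Colouring n → Sign → ℕ
edgeCount {n} f s =
  sum (map (λ i → sum (map (λ j →
         if (toℕ i <ᵇ toℕ j) ∧ ⌊ SignP._≟_ (col f i j) s ⌋ then 1 else 0)
       (allFin n))) (allFin n))

walkValue : ∀ {n} → Colouring n → List (Fin n) → ℤ
walkValue f []           = 0ℤ
walkValue f (v ∷ [])     = 0ℤ
walkValue f (u ∷ v ∷ vs) = val (col f u v) +ℤ walkValue f (v ∷ vs)

pathVerts : ∀ {n} → Fin n → List (Fin n) → Fin n → List (Fin n)
pathVerts x ms y = x ∷ (ms ++ y ∷ [])

pathLength : ∀ {n} → List (Fin n) → ℕ
pathLength ms = suc (length ms)

-- Suppose x and y are joined by no balanced path of length 2 or 4. Then every path x z y is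
-- monochromatic, so a path x z₁ z₂ z₃ y is balanced as soon as xz₁ ≠ xz₃ and z₁z₂ ≠ z₂z₃, or
-- xz₁ = xz₃ and z₁z₂ = z₂z₃ ≠ xz₁. If x sends a single colour s to all other vertices z ≠ y, these
-- two rules make the opposite colour a matching, with at most n/2 edges. Otherwise some colour s
-- is sent from x to exactly one such vertex a and the other colour to at least two, and the rules
-- confine every s-edge to the triangle x y a, so there are at most 3 ≤ n/2 of them. Either way a
-- colour has fewer than ⌈(n+1)/2⌉ edges. For sharpness, colour - exactly the pairs {2k, 2k+1}:
-- a balanced path from 0 to 1 of length 4 would need two adjacent - edges.
module Submission where

open import Defs
import Algebra.Properties.CommutativeMonoid.Sum as Sum
open import Data.Bool using (true; false; if_then_else_; _∧_; T)
open import Data.Empty using (⊥-elim)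
open import Data.Fin using (Fin; zero; suc; toℕ; _≟_)
open import Data.Fin.Properties using (any?; toℕ-injective)
open import Data.Integer using (0ℤ) renaming (_+_ to _+ℤ_; _≟_ to _≟ℤ_)
open import Data.List using (List; []; _∷_; _++_; length; map; allFin; tabulate)
open import Data.List.Properties using (map-tabulate)
open import Data.List.Membership.Propositional using (_∈_; _∉_)
open import Data.List.Relation.Unary.All using ([]; _∷_)
open import Data.List.Relation.Unary.AllPairs using ([]; _∷_)
open import Data.List.Relation.Unary.Any using (here; there)
open import Data.List.Relation.Unary.Unique.Propositional using (Unique)
import Data.List.Relation.Unary.Unique.DecPropositional as UniqueDec
open import Data.Nat using (ℕ; zero; suc; _≤_; _<_; _+_; _*_; _⊓_; _∸_; _<ᵇ_; _≡ᵇ_; z≤n; s≤s; ⌊_/2⌋; ⌈_/2⌉)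
import Data.Nat.ListAction as ListAction
open import Data.Nat.Properties hiding (_≟_)
open import Data.Product using (_×_; _,_; proj₁; proj₂; ∃; ∃-syntax)
open import Data.Sign using (Sign; opposite) renaming (- to minus; + to plus)
open import Data.Sign.Properties using (s≢opposite[s]) renaming (_≟_ to _≟ˢ_)
open import Data.Sum using (_⊎_; inj₁; inj₂)
open import Function using (_∘_)
open import Relation.Nullary using (Dec; yes; no; ¬_; ¬?; does)
open import Relation.Nullary.Decidable using (⌊_⌋; _×-dec_; decidable-stable; dec-true)
open import Relation.Binary.PropositionalEquality

open Sum +-0-commutativeMonoid using (sum-syntax; ∑-distrib-+; ∑-comm; sum-cong-≗; sum-replicate-zero)

∑-mono-≤ : ∀ {n} {g h : Fin n → ℕ} → (∀ i → g i ≤ h i) → ∑[ i < n ] g i ≤ ∑[ i < n ] h i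
∑-mono-≤ {zero}  g≤h = z≤n
∑-mono-≤ {suc n} g≤h = +-mono-≤ (g≤h zero) (∑-mono-≤ (g≤h ∘ suc))

∑-const-1 : ∀ n → ∑[ i < n ] 1 ≡ n
∑-const-1 zero    = refl
∑-const-1 (suc n) = cong suc (∑-const-1 n)

sum-tabulate : ∀ {n} (g : Fin n → ℕ) → ListAction.sum (tabulate g) ≡ ∑[ i < n ] g i
sum-tabulate {zero}  g = refl
sum-tabulate {suc n} g = cong (g zero +_) (sum-tabulate (g ∘ suc))

sum-map-allFin : ∀ {n} (g : Fin n → ℕ) → ListAction.sum (map g (allFin n)) ≡ ∑[ i < n ] g i
sum-map-allFin g = trans (cong ListAction.sum (map-tabulate (λ i → i) g)) (sum-tabulate g)

δ : ∀ {n} → Fin n → Fin n → ℕ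
δ i j = if does (i ≟ j) then 1 else 0

δ-refl : ∀ {n} (i : Fin n) → δ i i ≡ 1
δ-refl i = cong (if_then 1 else 0) (dec-true (i ≟ i) refl)

∑-δ : ∀ {n} (j : Fin n) → ∑[ i < n ] δ i j ≡ 1
∑-δ {suc n} zero    = cong suc (sum-replicate-zero n)
∑-δ {suc n} (suc j) = ∑-δ j

multiplicity : ∀ {n} → List (Fin n) → Fin n → ℕ
multiplicity []      i = 0
multiplicity (j ∷ M) i = δ i j + multiplicity M i

∑-multiplicity : ∀ {n} (M : List (Fin n)) → ∑[ i < n ] multiplicity M i ≡ length M
∑-multiplicity {n} []  = sum-replicate-zero n
∑-multiplicity (j ∷ M) =
  trans (∑-distrib-+ (λ i → δ i j) (multiplicity M)) (cong₂ _+_ (∑-δ j) (∑-multiplicity M))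

multiplicity-++ : ∀ {n} (M N : List (Fin n)) i → multiplicity (M ++ N) i ≡ multiplicity M i + multiplicity N i
multiplicity-++ []      N i = refl
multiplicity-++ (j ∷ M) N i = trans (cong (δ i j +_) (multiplicity-++ M N i)) (sym (+-assoc (δ i j) _ _))

∈⇒multiplicity>0 : ∀ {n} {i : Fin n} {M} → i ∈ M → 0 < multiplicity M i
∈⇒multiplicity>0 {i = i} {M = _ ∷ M} (here refl) rewrite δ-refl i = s≤s z≤n
∈⇒multiplicity>0 {i = i} {M = j ∷ M} (there i∈M) = ≤-trans (∈⇒multiplicity>0 i∈M) (m≤n+m _ (δ i j))

short-list-misses : ∀ {n} (M : List (Fin n)) → length M < n → ∃ λ z → z ∉ M
short-list-misses {n} M |M|<n with any? (λ z → multiplicity M z Data.Nat.≟ 0)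
... | yes (z , z∉M) = z , λ z∈M → <⇒≢ (∈⇒multiplicity>0 z∈M) (sym z∉M)
... | no ¬∃ = ⊥-elim (<⇒≱ |M|<n (begin
  n                              ≡⟨ sym (∑-const-1 n) ⟩
  ∑[ i < n ] 1                   ≤⟨ ∑-mono-≤ (λ i → n≢0⇒n>0 (λ m≡0 → ¬∃ (i , m≡0))) ⟩
  ∑[ i < n ] multiplicity M i    ≡⟨ ∑-multiplicity M ⟩
  length M                       ∎))
  where open ≤-Reasoning

edgeIndicator : ∀ {n} → Colouring n → Sign → Fin n → Fin n → ℕ
edgeIndicator f s i j = if (toℕ i <ᵇ toℕ j) ∧ ⌊ col f i j ≟ˢ s ⌋ then 1 else 0

edgeCount≡∑∑edgeIndicator : ∀ {n} (f : Colouring n) s →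
  edgeCount f s ≡ ∑[ i < n ] ∑[ j < n ] edgeIndicator f s i j
edgeCount≡∑∑edgeIndicator {n} f s =
  trans (sum-map-allFin (λ i → ListAction.sum (map (edgeIndicator f s i) (allFin n))))
        (sum-cong-≗ (sum-map-allFin ∘ edgeIndicator f s))

indicator≤ : ∀ {P : Set} (P? : Dec P) {k} → (P → 0 < k) → (if ⌊ P? ⌋ then 1 else 0) ≤ k
indicator≤ (yes p) 0<k = 0<k p
indicator≤ (no _)  _   = z≤n

<ᵇ≡true⇒< : ∀ m n → (m <ᵇ n) ≡ true → m < n
<ᵇ≡true⇒< m n m<ᵇn = <ᵇ⇒< m n (subst T (sym m<ᵇn) _)

edgeIndicator-both≤ : ∀ {n} (f : Colouring n) s (i j : Fin n) {k} →
  (i ≢ j → col f i j ≡ s → 0 < k) → edgeIndicator f s i j + edgeIndicator f s j i ≤ k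
edgeIndicator-both≤ f s i j edge⇒0<k with toℕ i <ᵇ toℕ j in i<j | toℕ j <ᵇ toℕ i in j<i
... | true  | true  = ⊥-elim (<-asym (<ᵇ≡true⇒< (toℕ i) _ i<j) (<ᵇ≡true⇒< (toℕ j) _ j<i))
... | false | false = z≤n
... | true  | false = ≤-trans (≤-reflexive (+-identityʳ _))
      (indicator≤ (col f i j ≟ˢ s) (edge⇒0<k (λ { refl → <-irrefl refl (<ᵇ≡true⇒< (toℕ i) _ i<j) })))
... | false | true  = indicator≤ (col f j i ≟ˢ s)
      (edge⇒0<k (λ { refl → <-irrefl refl (<ᵇ≡true⇒< (toℕ j) _ j<i) }) ∘ trans (symm f i j))

handshake-≤ : ∀ {n} (f : Colouring n) s (N : Fin n → List (Fin n)) →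
  (∀ i j → i ≢ j → col f i j ≡ s → j ∈ N i) →
  2 * edgeCount f s ≤ ∑[ i < n ] length (N i)
handshake-≤ {n} f s N neighbours = begin
  2 * edgeCount f s                                    ≡⟨ cong (2 *_) (edgeCount≡∑∑edgeIndicator f s) ⟩
  E + (E + 0)                                          ≡⟨ cong (E +_) (trans (+-identityʳ E) (∑-comm e)) ⟩
  E + ∑[ i < n ] ∑[ j < n ] e j i                      ≡⟨ sym (∑-distrib-+ (λ i → ∑[ j < n ] e i j) (λ i → ∑[ j < n ] e j i)) ⟩
  ∑[ i < n ] (∑[ j < n ] e i j + ∑[ j < n ] e j i)      ≡⟨ sum-cong-≗ (λ i → sym (∑-distrib-+ (e i) (λ j → e j i))) ⟩
  ∑[ i < n ] ∑[ j < n ] (e i j + e j i)                ≤⟨ ∑-mono-≤ (λ i → ∑-mono-≤ (λ j →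
                                                           edgeIndicator-both≤ f s i j (λ i≢j ij →
                                                             ∈⇒multiplicity>0 (neighbours i j i≢j ij)))) ⟩
  ∑[ i < n ] ∑[ j < n ] multiplicity (N i) j           ≡⟨ sum-cong-≗ (∑-multiplicity ∘ N) ⟩
  ∑[ i < n ] length (N i)                              ∎
  where
  open ≤-Reasoning
  e : Fin n → Fin n → ℕ
  e = edgeIndicator f s
  E : ℕ
  E = ∑[ i < n ] ∑[ j < n ] e i j

IsMatching : ∀ {n} → Colouring n → Sign → Set
IsMatching f s = ∀ i j k → i ≢ j → i ≢ k → col f i j ≡ s → col f i k ≡ s → j ≡ k

matching⇒2*edgeCount≤n : ∀ {n} (f : Colouring n) s → IsMatching f s → 2 * edgeCount f s ≤ n
matching⇒2*edgeCount≤n {n} f s matching = begin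
  2 * edgeCount f s        ≤⟨ handshake-≤ f s N neighbours ⟩
  ∑[ i < n ] length (N i)  ≤⟨ ∑-mono-≤ |N|≤1 ⟩
  ∑[ i < n ] 1             ≡⟨ ∑-const-1 n ⟩
  n                        ∎
  where
  open ≤-Reasoning
  neighbour? : ∀ i → Dec (∃ λ j → i ≢ j × col f i j ≡ s)
  neighbour? i = any? (λ j → ¬? (i ≟ j) ×-dec (col f i j ≟ˢ s))
  N : Fin n → List (Fin n)
  N i with neighbour? i
  ... | yes (j , _) = j ∷ []
  ... | no _        = []
  neighbours : ∀ i j → i ≢ j → col f i j ≡ s → j ∈ N i
  neighbours i j i≢j ij with neighbour? i
  ... | yes (k , i≢k , ik) = here (matching i j k i≢j i≢k ij ik)
  ... | no ¬∃              = ⊥-elim (¬∃ (j , i≢j , ij))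
  |N|≤1 : ∀ i → length (N i) ≤ 1
  |N|≤1 i with neighbour? i
  ... | yes _ = s≤s z≤n
  ... | no _  = z≤n

within-triangle⇒2*edgeCount≤6 : ∀ {n} (f : Colouring n) s (p q r : Fin n) →
  (∀ i j → i ≢ j → col f i j ≡ s → i ∈ p ∷ q ∷ r ∷ []) → 2 * edgeCount f s ≤ 6
within-triangle⇒2*edgeCount≤6 {n} f s p q r endpoint = begin
  2 * edgeCount f s                       ≤⟨ handshake-≤ f s N neighbours ⟩
  ∑[ i < n ] length (N i)                 ≤⟨ ∑-mono-≤ |N|≤multiplicity ⟩
  ∑[ i < n ] multiplicity (pqr ++ pqr) i  ≡⟨ ∑-multiplicity (pqr ++ pqr) ⟩
  6                                       ∎
  where
  open ≤-Reasoning
  pqr : List (Fin n)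
  pqr = p ∷ q ∷ r ∷ []
  N : Fin n → List (Fin n)
  N i with i ≟ p | i ≟ q | i ≟ r
  ... | yes _ | _     | _     = q ∷ r ∷ []
  ... | no _  | yes _ | _     = p ∷ r ∷ []
  ... | no _  | no _  | yes _ = p ∷ q ∷ []
  ... | no _  | no _  | no _  = []
  neighbours : ∀ i j → i ≢ j → col f i j ≡ s → j ∈ N i
  neighbours i j i≢j ij with endpoint j i (i≢j ∘ sym) (trans (symm f j i) ij) | i ≟ p | i ≟ q | i ≟ r
  ... | here refl                 | yes refl | _        | _        = ⊥-elim (i≢j refl)
  ... | there j∈qr                | yes refl | _        | _        = j∈qr
  ... | here j≡p                  | no _     | yes refl | _        = here j≡p
  ... | there (here refl)         | no _     | yes refl | _        = ⊥-elim (i≢j refl)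
  ... | there (there j∈r)         | no _     | yes refl | _        = there j∈r
  ... | here j≡p                  | no _     | no _     | yes refl = here j≡p
  ... | there (here j≡q)          | no _     | no _     | yes refl = there (here j≡q)
  ... | there (there (here refl)) | no _     | no _     | yes refl = ⊥-elim (i≢j refl)
  ... | _                         | no i≢p   | no i≢q   | no i≢r   with endpoint i j i≢j ij
  ...   | here i≡p                 = ⊥-elim (i≢p i≡p)
  ...   | there (here i≡q)         = ⊥-elim (i≢q i≡q)
  ...   | there (there (here i≡r)) = ⊥-elim (i≢r i≡r)
  twice : ∀ {i} → i ∈ pqr → 2 ≤ multiplicity (pqr ++ pqr) i
  twice {i} i∈pqr = subst (2 ≤_) (sym (multiplicity-++ pqr pqr i))
    (+-mono-≤ (∈⇒multiplicity>0 i∈pqr) (∈⇒multiplicity>0 i∈pqr))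
  |N|≤ : ∀ i {m} → (i ∈ pqr → 2 ≤ m) → length (N i) ≤ m
  |N|≤ i 2≤m with i ≟ p | i ≟ q | i ≟ r
  ... | yes i≡p | _       | _       = 2≤m (here i≡p)
  ... | no _    | yes i≡q | _       = 2≤m (there (here i≡q))
  ... | no _    | no _    | yes i≡r = 2≤m (there (there (here i≡r)))
  ... | no _    | no _    | no _    = z≤n
  |N|≤multiplicity : ∀ i → length (N i) ≤ multiplicity (pqr ++ pqr) i
  |N|≤multiplicity i = |N|≤ i twice

∉⇒≢ : ∀ {A : Set} {z u : A} {M : List A} → z ∉ M → u ∈ M → z ≢ u
∉⇒≢ z∉M u∈M refl = z∉M u∈M

≢⇒≡opposite : ∀ {s t : Sign} → s ≢ t → t ≡ opposite s
≢⇒≡opposite {minus} {minus} s≢t = ⊥-elim (s≢t refl)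
≢⇒≡opposite {minus} {plus}  _   = refl
≢⇒≡opposite {plus}  {minus} _   = refl
≢⇒≡opposite {plus}  {plus}  s≢t = ⊥-elim (s≢t refl)

≡-or-≡opposite : ∀ t s → t ≡ s ⊎ t ≡ opposite s
≡-or-≡opposite t s with t ≟ˢ s
... | yes t≡s = inj₁ t≡s
... | no t≢s  = inj₂ (≢⇒≡opposite (≢-sym t≢s))

balanced-ab : ∀ {a b} → a ≢ b → val a +ℤ (val b +ℤ 0ℤ) ≡ 0ℤ
balanced-ab {minus} a≢b rewrite ≢⇒≡opposite a≢b = refl
balanced-ab {plus}  a≢b rewrite ≢⇒≡opposite a≢b = refl

balanced-abba : ∀ {a b c d} → a ≢ b → c ≡ b → d ≡ a →
  val a +ℤ (val b +ℤ (val c +ℤ (val d +ℤ 0ℤ))) ≡ 0ℤ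
balanced-abba {minus} a≢b refl refl rewrite ≢⇒≡opposite a≢b = refl
balanced-abba {plus}  a≢b refl refl rewrite ≢⇒≡opposite a≢b = refl

balanced-abcd : ∀ {a b c d} → a ≢ d → b ≢ c →
  val a +ℤ (val b +ℤ (val c +ℤ (val d +ℤ 0ℤ))) ≡ 0ℤ
balanced-abcd {minus} {minus} a≢d b≢c rewrite ≢⇒≡opposite a≢d | ≢⇒≡opposite b≢c = refl
balanced-abcd {minus} {plus}  a≢d b≢c rewrite ≢⇒≡opposite a≢d | ≢⇒≡opposite b≢c = refl
balanced-abcd {plus}  {minus} a≢d b≢c rewrite ≢⇒≡opposite a≢d | ≢⇒≡opposite b≢c = refl
balanced-abcd {plus}  {plus}  a≢d b≢c rewrite ≢⇒≡opposite a≢d | ≢⇒≡opposite b≢c = refl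

module WithoutBalancedShortPaths {n} (f : Colouring n) {x y : Fin n} (x≢y : x ≢ y)
  (monochromatic₂ : ∀ z → z ≢ x → z ≢ y → col f x z ≡ col f z y)
  (unbalanced₄ : ∀ z₁ z₂ z₃ → Unique (x ∷ z₁ ∷ z₂ ∷ z₃ ∷ y ∷ []) →
                 walkValue f (x ∷ z₁ ∷ z₂ ∷ z₃ ∷ y ∷ []) ≢ 0ℤ)
  where

  c : Fin n → Fin n → Sign
  c = col f

  Inner : Fin n → Set
  Inner z = z ≢ x × z ≢ y

  inner? : ∀ z → Dec (Inner z)
  inner? z = ¬? (z ≟ x) ×-dec ¬? (z ≟ y)

  ∉xy⇒Inner : ∀ {z M} → z ∉ x ∷ y ∷ M → Inner z
  ∉xy⇒Inner z∉ = ∉⇒≢ z∉ (here refl) , ∉⇒≢ z∉ (there (here refl))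

  neighbour-inner : ∀ {i j} → Inner i → c i j ≢ c x i → Inner j
  neighbour-inner {i} (i≢x , i≢y) ij≢xi =
    (λ { refl → ij≢xi (symm f i x) }) , (λ { refl → ij≢xi (sym (monochromatic₂ i i≢x i≢y)) })

  route : ∀ {z₁ z₂ z₃} → Inner z₁ → Inner z₂ → Inner z₃ → z₁ ≢ z₂ → z₁ ≢ z₃ → z₂ ≢ z₃ →
          Unique (x ∷ z₁ ∷ z₂ ∷ z₃ ∷ y ∷ [])
  route (z₁≢x , z₁≢y) (z₂≢x , z₂≢y) (z₃≢x , z₃≢y) z₁≢z₂ z₁≢z₃ z₂≢z₃ =
    (≢-sym z₁≢x ∷ ≢-sym z₂≢x ∷ ≢-sym z₃≢x ∷ x≢y ∷ []) ∷ (z₁≢z₂ ∷ z₁≢z₃ ∷ z₁≢y ∷ []) ∷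
    (z₂≢z₃ ∷ z₂≢y ∷ []) ∷ (z₃≢y ∷ []) ∷ [] ∷ []

  route-value : ∀ {z₁ z₂ z₃} → Unique (x ∷ z₁ ∷ z₂ ∷ z₃ ∷ y ∷ []) →
    walkValue f (x ∷ z₁ ∷ z₂ ∷ z₃ ∷ y ∷ []) ≡
      val (c x z₁) +ℤ (val (c z₁ z₂) +ℤ (val (c z₂ z₃) +ℤ (val (c x z₃) +ℤ 0ℤ)))
  route-value {z₁} {z₂} {z₃} ((_ ∷ _ ∷ x≢z₃ ∷ _) ∷ _ ∷ _ ∷ (z₃≢y ∷ []) ∷ _) =
    cong (λ u → val (c x z₁) +ℤ (val (c z₁ z₂) +ℤ (val (c z₂ z₃) +ℤ (val u +ℤ 0ℤ))))
         (sym (monochromatic₂ z₃ (≢-sym x≢z₃) z₃≢y))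

  same-ends⇒monochromatic : ∀ {z₁ z₂ z₃} → Unique (x ∷ z₁ ∷ z₂ ∷ z₃ ∷ y ∷ []) →
    c x z₁ ≡ c x z₃ → c z₁ z₂ ≡ c z₂ z₃ → c z₁ z₂ ≡ c x z₁
  same-ends⇒monochromatic {z₁} {z₂} {z₃} r ends middle =
    decidable-stable (c z₁ z₂ ≟ˢ c x z₁) λ middle≢end →
      unbalanced₄ z₁ z₂ z₃ r (trans (route-value r) (balanced-abba (≢-sym middle≢end) (sym middle) (sym ends)))

  different-ends⇒same-middle : ∀ {z₁ z₂ z₃} → Unique (x ∷ z₁ ∷ z₂ ∷ z₃ ∷ y ∷ []) →
    c x z₁ ≢ c x z₃ → c z₁ z₂ ≡ c z₂ z₃
  different-ends⇒same-middle {z₁} {z₂} {z₃} r ends≢ =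
    decidable-stable (c z₁ z₂ ≟ˢ c z₂ z₃) λ middle≢ →
      unbalanced₄ z₁ z₂ z₃ r (trans (route-value r) (balanced-abcd ends≢ middle≢))

  constant⇒opposite-matching : ∀ s → (∀ z → Inner z → c x z ≡ s) → IsMatching f (opposite s)
  constant⇒opposite-matching s constant i j k i≢j i≢k ij ik with i ≟ x | i ≟ y
  ... | yes refl | _        = trans (x-partner i≢j ij) (sym (x-partner i≢k ik))
    where
    x-partner : ∀ {j} → x ≢ j → c x j ≡ opposite s → j ≡ y
    x-partner {j} x≢j xj = decidable-stable (j ≟ y) λ j≢y →
      s≢opposite[s] s (trans (sym (constant j (≢-sym x≢j , j≢y))) xj)
  ... | no _     | yes refl = trans (y-partner i≢j ij) (sym (y-partner i≢k ik))
    where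
    y-partner : ∀ {j} → y ≢ j → c y j ≡ opposite s → j ≡ x
    y-partner {j} y≢j yj = decidable-stable (j ≟ x) λ j≢x →
      s≢opposite[s] s (trans (sym (constant j (j≢x , ≢-sym y≢j)))
                             (trans (monochromatic₂ j j≢x (≢-sym y≢j)) (trans (symm f j y) yj)))
  ... | no i≢x   | no i≢y   = decidable-stable (j ≟ k) λ j≢k →
    s≢opposite[s] s (begin
      s        ≡⟨ sym (constant j j-inner) ⟩
      c x j    ≡⟨ sym (same-ends⇒monochromatic (route j-inner i-inner k-inner (≢-sym i≢j) j≢k i≢k)
                    (trans (constant j j-inner) (sym (constant k k-inner)))
                    (trans (symm f j i) (trans ij (sym ik)))) ⟩
      c j i    ≡⟨ trans (symm f j i) ij ⟩
      opposite s ∎)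
    where
    open ≡-Reasoning
    i-inner : Inner i
    i-inner = i≢x , i≢y
    opposite-edge⇒Inner : ∀ {j} → c i j ≡ opposite s → Inner j
    opposite-edge⇒Inner ij = neighbour-inner i-inner λ ij≡xi →
      s≢opposite[s] s (trans (sym (constant i i-inner)) (trans (sym ij≡xi) ij))
    j-inner : Inner j
    j-inner = opposite-edge⇒Inner ij
    k-inner : Inner k
    k-inner = opposite-edge⇒Inner ik

  Class : Sign → Fin n → Set
  Class s z = Inner z × c x z ≡ s

  opposite-classes-differ : ∀ {s a b} → Class s a → Class (opposite s) b → c x a ≢ c x b
  opposite-classes-differ {s} (_ , xa) (_ , xb) xa≡xb = s≢opposite[s] s (trans (sym xa) (trans xa≡xb xb))

  opposite-classes-disjoint : ∀ {s a b} → Class s a → Class (opposite s) b → a ≢ b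
  opposite-classes-disjoint A B refl = opposite-classes-differ A B refl

  across : ∀ {s a b b′} → Class s a → Class (opposite s) b → Class (opposite s) b′ → b ≢ b′ →
           c a b ≡ opposite s
  across {s} {a} {b} {b′} A B B′ b≢b′ = begin
    c a b       ≡⟨ symm f a b ⟩
    c b a       ≡⟨ same-ends⇒monochromatic (route (proj₁ B) (proj₁ A) (proj₁ B′) (≢-sym a≢b) b≢b′ a≢b′)
                     (trans (proj₂ B) (sym (proj₂ B′))) b-a≡a-b′ ⟩
    c x b       ≡⟨ proj₂ B ⟩
    opposite s  ∎
    where
    open ≡-Reasoning
    a≢b : a ≢ b
    a≢b = opposite-classes-disjoint A B
    a≢b′ : a ≢ b′
    a≢b′ = opposite-classes-disjoint A B′
    b-a≡a-b′ : c b a ≡ c a b′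
    b-a≡a-b′ = begin
      c b a   ≡⟨ symm f b a ⟩
      c a b   ≡⟨ different-ends⇒same-middle (route (proj₁ A) (proj₁ B) (proj₁ B′) a≢b a≢b′ b≢b′)
                   (opposite-classes-differ A B′) ⟩
      c b b′  ≡⟨ symm f b b′ ⟩
      c b′ b  ≡⟨ sym (different-ends⇒same-middle (route (proj₁ A) (proj₁ B′) (proj₁ B) a≢b′ a≢b (≢-sym b≢b′))
                   (opposite-classes-differ A B)) ⟩
      c a b′  ∎

  module Mixed (s : Sign) {a b b′ : Fin n} (A : Class s a)
    (B : Class (opposite s) b) (B′ : Class (opposite s) b′) (b≢b′ : b ≢ b′) where

    A-B : ∀ {a₀ b₀} → Class s a₀ → Class (opposite s) b₀ → c a₀ b₀ ≡ opposite s
    A-B {b₀ = b₀} A₀ B₀ with b₀ ≟ b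
    ... | yes refl = across A₀ B₀ B′ b≢b′
    ... | no b₀≢b  = across A₀ B₀ B b₀≢b

    B-B : ∀ {b₁ b₂} → Class (opposite s) b₁ → Class (opposite s) b₂ → b₁ ≢ b₂ → c b₁ b₂ ≡ opposite s
    B-B B₁ B₂ b₁≢b₂ =
      trans (sym (different-ends⇒same-middle
              (route (proj₁ A) (proj₁ B₁) (proj₁ B₂) (opposite-classes-disjoint A B₁) (opposite-classes-disjoint A B₂) b₁≢b₂)
              (opposite-classes-differ A B₂)))
            (A-B A B₁)

    A-unique : ∀ {a₀} → Class s a₀ → a₀ ≡ a
    A-unique {a₀} A₀ = decidable-stable (a₀ ≟ a) λ a₀≢a → s≢opposite[s] s (begin
      s          ≡⟨ sym (proj₂ A) ⟩
      c x a      ≡⟨ sym (same-ends⇒monochromatic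
                      (route (proj₁ A) (proj₁ B) (proj₁ A₀) (opposite-classes-disjoint A B) (≢-sym a₀≢a)
                        (≢-sym (opposite-classes-disjoint A₀ B)))
                      (trans (proj₂ A) (sym (proj₂ A₀))) (trans (A-B A B) (sym (trans (symm f b a₀) (A-B A₀ B))))) ⟩
      c a b      ≡⟨ A-B A B ⟩
      opposite s ∎)
      where open ≡-Reasoning

    from-B : ∀ {i} j → Class (opposite s) i → i ≢ j → c i j ≡ opposite s
    from-B {i} j I i≢j with c i j ≟ˢ c x i
    ... | yes ij≡xi = trans ij≡xi (proj₂ I)
    ... | no ij≢xi with ≡-or-≡opposite (c x j) s
    ...   | inj₁ xj≡s = trans (symm f i j) (A-B (neighbour-inner (proj₁ I) ij≢xi , xj≡s) I)
    ...   | inj₂ xj≡opposite-s = B-B I (neighbour-inner (proj₁ I) ij≢xi , xj≡opposite-s) i≢j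

    s-edge-endpoint : ∀ i j → i ≢ j → c i j ≡ s → i ∈ x ∷ y ∷ a ∷ []
    s-edge-endpoint i j i≢j ij with i ≟ x | i ≟ y
    ... | yes i≡x | _       = here i≡x
    ... | no _    | yes i≡y = there (here i≡y)
    ... | no i≢x  | no i≢y  with ≡-or-≡opposite (c x i) s
    ...   | inj₁ xi≡s = there (there (here (A-unique ((i≢x , i≢y) , xi≡s))))
    ...   | inj₂ xi≡opposite-s = ⊥-elim (s≢opposite[s] s (trans (sym ij) (from-B j ((i≢x , i≢y) , xi≡opposite-s) i≢j)))

    2*edgeCount≤6 : 2 * edgeCount f s ≤ 6
    2*edgeCount≤6 = within-triangle⇒2*edgeCount≤6 f s x y a s-edge-endpoint

  sparse-colour : 6 ≤ n → ∃ λ s → 2 * edgeCount f s ≤ n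
  sparse-colour 6≤n with short-list-misses (x ∷ y ∷ []) (≤-trans (m≤m+n 3 3) 6≤n)
  ... | a , a∉ with any? (λ z → inner? z ×-dec ¬? (c x z ≟ˢ c x a))
  ...   | no ¬∃ = opposite (c x a) , matching⇒2*edgeCount≤n f (opposite (c x a))
                    (constant⇒opposite-matching (c x a) λ z Z →
                      decidable-stable (c x z ≟ˢ c x a) λ xz≢xa → ¬∃ (z , Z , xz≢xa))
  ...   | yes (b , b-inner , xb≢xa) with short-list-misses (x ∷ y ∷ a ∷ b ∷ []) (≤-trans (n≤1+n 5) 6≤n)
  ...     | d , d∉ with ≡-or-≡opposite (c x d) (c x a)
  ...       | inj₁ xd≡xa = c x b , ≤-trans (Mixed.2*edgeCount≤6 (c x b) (b-inner , refl)
                              (∉xy⇒Inner a∉ , xa≡opposite-xb) (∉xy⇒Inner d∉ , trans xd≡xa xa≡opposite-xb)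
                              (≢-sym (∉⇒≢ d∉ (there (there (here refl)))))) 6≤n
    where
    xa≡opposite-xb : c x a ≡ opposite (c x b)
    xa≡opposite-xb = ≢⇒≡opposite xb≢xa
  ...       | inj₂ xd≡opposite-xa = c x a , ≤-trans (Mixed.2*edgeCount≤6 (c x a) (∉xy⇒Inner a∉ , refl)
                              (b-inner , ≢⇒≡opposite (≢-sym xb≢xa)) (∉xy⇒Inner d∉ , xd≡opposite-xa)
                              (≢-sym (∉⇒≢ d∉ (there (there (there (here refl))))))) 6≤n

n<2*⌈1+n/2⌉ : ∀ n → n < 2 * ⌈ suc n /2⌉
n<2*⌈1+n/2⌉ n = begin
  suc n                              ≡⟨ sym (⌊n/2⌋+⌈n/2⌉≡n (suc n)) ⟩
  ⌊ suc n /2⌋ + ⌈ suc n /2⌉           ≤⟨ +-monoˡ-≤ ⌈ suc n /2⌉ (⌊n/2⌋≤⌈n/2⌉ (suc n)) ⟩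
  ⌈ suc n /2⌉ + ⌈ suc n /2⌉           ≡⟨ cong (⌈ suc n /2⌉ +_) (sym (+-identityʳ ⌈ suc n /2⌉)) ⟩
  2 * ⌈ suc n /2⌉                     ∎
  where open ≤-Reasoning

threshold⇒¬sparse : ∀ {n} (f : Colouring n) →
  ⌈ suc n /2⌉ ≤ edgeCount f minus ⊓ edgeCount f plus → ¬ (∃ λ s → 2 * edgeCount f s ≤ n)
threshold⇒¬sparse {n} f threshold (s , sparse) =
  <⇒≱ (<-≤-trans (n<2*⌈1+n/2⌉ n) (*-monoʳ-≤ 2 (≤-trans threshold (minimum≤ s)))) sparse
  where
  minimum≤ : ∀ s → edgeCount f minus ⊓ edgeCount f plus ≤ edgeCount f s
  minimum≤ minus = m⊓n≤m _ _
  minimum≤ plus  = m⊓n≤n _ _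

balanced-path-exists : (n : ℕ) → 6 ≤ n → (f : Colouring n) →
  ⌈ suc n /2⌉ ≤ edgeCount f minus ⊓ edgeCount f plus →
  (x y : Fin n) → x ≢ y →
  ∃[ ms ] (Unique (pathVerts x ms y) × pathLength ms ≤ 4 × walkValue f (pathVerts x ms y) ≡ 0ℤ)
balanced-path-exists n 6≤n f threshold x y x≢y
  with any? (λ z → ¬? (z ≟ x) ×-dec (¬? (z ≟ y) ×-dec ¬? (col f x z ≟ˢ col f z y)))
... | yes (z , z≢x , z≢y , xz≢zy) =
  z ∷ [] , (≢-sym z≢x ∷ x≢y ∷ []) ∷ (z≢y ∷ []) ∷ [] ∷ [] , s≤s (s≤s z≤n) , balanced-ab xz≢zy
... | no no-path₂ with any? (λ z₁ → any? λ z₂ → any? λ z₃ →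
        UniqueDec.unique? _≟_ (x ∷ z₁ ∷ z₂ ∷ z₃ ∷ y ∷ [])
          ×-dec (walkValue f (x ∷ z₁ ∷ z₂ ∷ z₃ ∷ y ∷ []) ≟ℤ 0ℤ))
...   | yes (z₁ , z₂ , z₃ , unique , balanced) = z₁ ∷ z₂ ∷ z₃ ∷ [] , unique , ≤-refl , balanced
...   | no no-path₄ = ⊥-elim (threshold⇒¬sparse f threshold
                       (WithoutBalancedShortPaths.sparse-colour f x≢y monochromatic₂ unbalanced₄ 6≤n))
  where
  monochromatic₂ : ∀ z → z ≢ x → z ≢ y → col f x z ≡ col f z y
  monochromatic₂ z z≢x z≢y =
    decidable-stable (col f x z ≟ˢ col f z y) λ xz≢zy → no-path₂ (z , z≢x , z≢y , xz≢zy)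
  unbalanced₄ : ∀ z₁ z₂ z₃ → Unique (x ∷ z₁ ∷ z₂ ∷ z₃ ∷ y ∷ []) →
                walkValue f (x ∷ z₁ ∷ z₂ ∷ z₃ ∷ y ∷ []) ≢ 0ℤ
  unbalanced₄ z₁ z₂ z₃ unique balanced = no-path₄ (z₁ , z₂ , z₃ , unique , balanced)

≡ᵇ-sym : ∀ m n → (m ≡ᵇ n) ≡ (n ≡ᵇ m)
≡ᵇ-sym zero    zero    = refl
≡ᵇ-sym zero    (suc n) = refl
≡ᵇ-sym (suc m) zero    = refl
≡ᵇ-sym (suc m) (suc n) = ≡ᵇ-sym m n

pairing : ∀ n → Colouring n
pairing n = record
  { col  = λ i j → if ⌊ toℕ i /2⌋ ≡ᵇ ⌊ toℕ j /2⌋ then minus else plus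
  ; symm = λ i j → cong (if_then minus else plus) (≡ᵇ-sym ⌊ toℕ i /2⌋ ⌊ toℕ j /2⌋)
  }

pairing-minus⇒same-half : ∀ {n} (i j : Fin n) → col (pairing n) i j ≡ minus → ⌊ toℕ i /2⌋ ≡ ⌊ toℕ j /2⌋
pairing-minus⇒same-half i j ij with ⌊ toℕ i /2⌋ ≡ᵇ ⌊ toℕ j /2⌋ in same
... | true = ≡ᵇ⇒≡ _ _ (subst T (sym same) _)

partner : ℕ → ℕ
partner zero                = 1
partner (suc zero)          = 0
partner (suc (suc m))       = suc (suc (partner m))

same-half⇒partner : ∀ m n → ⌊ m /2⌋ ≡ ⌊ n /2⌋ → m ≢ n → n ≡ partner m
same-half⇒partner 0             0             _ m≢n = ⊥-elim (m≢n refl)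
same-half⇒partner 0             1             _ _   = refl
same-half⇒partner 1             0             _ _   = refl
same-half⇒partner 1             1             _ m≢n = ⊥-elim (m≢n refl)
same-half⇒partner 0             (suc (suc n)) ()
same-half⇒partner 1             (suc (suc n)) ()
same-half⇒partner (suc (suc m)) 0             ()
same-half⇒partner (suc (suc m)) 1             ()
same-half⇒partner (suc (suc m)) (suc (suc n)) h m≢n =
  cong (λ k → suc (suc k)) (same-half⇒partner m n (suc-injective h) (m≢n ∘ cong (λ k → suc (suc k))))

pairing-matching : ∀ n → IsMatching (pairing n) minus
pairing-matching _ i j k i≢j i≢k ij ik = toℕ-injective (begin
  toℕ j              ≡⟨ same-half⇒partner (toℕ i) (toℕ j) (pairing-minus⇒same-half i j ij) (i≢j ∘ toℕ-injective) ⟩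
  partner (toℕ i)    ≡⟨ same-half⇒partner (toℕ i) (toℕ k) (pairing-minus⇒same-half i k ik) (i≢k ∘ toℕ-injective) ⟨
  toℕ k              ∎)
  where open ≡-Reasoning

-- Vertices 0 and 1 carry the single minus edge {0,1}; the remaining rows are those of pairing n shifted by two.
∑∑pairing-minus : ∀ n → ∑[ i < n ] ∑[ j < n ] edgeIndicator (pairing n) minus i j ≡ ⌊ n /2⌋
∑∑pairing-minus zero          = refl
∑∑pairing-minus (suc zero)    = refl
∑∑pairing-minus (suc (suc n)) =
  cong₂ (λ zeros rest → suc zeros + (zeros + rest)) (sum-replicate-zero n) (∑∑pairing-minus n)

edgeCount-pairing-minus : ∀ n → edgeCount (pairing n) minus ≡ ⌊ n /2⌋
edgeCount-pairing-minus n = trans (edgeCount≡∑∑edgeIndicator (pairing n) minus) (∑∑pairing-minus n)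

-- Vertex 0 alone is joined by plus to each of 2, …, n + 1.
n≤edgeCount-pairing-plus : ∀ n → n ≤ edgeCount (pairing (2 + n)) plus
n≤edgeCount-pairing-plus n = begin
  n                                                          ≡⟨ sym (∑-const-1 n) ⟩
  ∑[ j < n ] 1                                               ≤⟨ m≤m+n (∑[ j < n ] 1) (∑[ i < 1 + n ] ∑[ j < 2 + n ] e (suc i) j) ⟩
  ∑[ i < 2 + n ] ∑[ j < 2 + n ] e i j                        ≡⟨ sym (edgeCount≡∑∑edgeIndicator (pairing (2 + n)) plus) ⟩
  edgeCount (pairing (2 + n)) plus                           ∎
  where
  open ≤-Reasoning
  e : Fin (2 + n) → Fin (2 + n) → ℕ
  e = edgeIndicator (pairing (2 + n)) plus

edgeCount-pairing-minimum : ∀ m → 1 ≤ m →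
  edgeCount (pairing (2 + m)) minus ⊓ edgeCount (pairing (2 + m)) plus ≡ ⌊ 2 + m /2⌋
edgeCount-pairing-minimum (suc m) _ =
  trans (cong (_⊓ edgeCount (pairing (3 + m)) plus) (edgeCount-pairing-minus (3 + m)))
        (m≤n⇒m⊓n≡m (≤-trans (⌊n/2⌋<n m) (n≤edgeCount-pairing-plus (suc m))))

three-signs-unbalanced : ∀ a b c → val a +ℤ (val b +ℤ (val c +ℤ 0ℤ)) ≢ 0ℤ
three-signs-unbalanced minus minus minus ()
three-signs-unbalanced minus minus plus  ()
three-signs-unbalanced minus plus  minus ()
three-signs-unbalanced minus plus  plus  ()
three-signs-unbalanced plus  minus minus ()
three-signs-unbalanced plus  minus plus  ()
three-signs-unbalanced plus  plus  minus ()
three-signs-unbalanced plus  plus  plus  ()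

balanced-plus-a-b-plus : ∀ a b → val plus +ℤ (val a +ℤ (val b +ℤ (val plus +ℤ 0ℤ))) ≡ 0ℤ →
  a ≡ minus × b ≡ minus
balanced-plus-a-b-plus minus minus _ = refl , refl
balanced-plus-a-b-plus minus plus  ()
balanced-plus-a-b-plus plus  minus ()
balanced-plus-a-b-plus plus  plus  ()

pairing-unbalanced : ∀ m (ms : List (Fin (2 + m))) → Unique (pathVerts zero ms (suc zero)) →
  pathLength ms ≤ 4 → walkValue (pairing (2 + m)) (pathVerts zero ms (suc zero)) ≢ 0ℤ
pairing-unbalanced m [] _ _ ()
pairing-unbalanced m (zero ∷ [])             ((0≢0 ∷ _) ∷ _)                   _ _ = 0≢0 refl
pairing-unbalanced m (suc zero ∷ [])         (_ ∷ (1≢1 ∷ _) ∷ _)               _ _ = 1≢1 refl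
pairing-unbalanced m (suc (suc _) ∷ [])      _                                 _ ()
pairing-unbalanced m (z₁ ∷ z₂ ∷ [])          _                                 _ =
  three-signs-unbalanced (col (pairing _) zero z₁) (col (pairing _) z₁ z₂) (col (pairing _) z₂ (suc zero))
pairing-unbalanced m (zero ∷ _ ∷ _ ∷ [])     ((0≢0 ∷ _) ∷ _)                   _ _ = 0≢0 refl
pairing-unbalanced m (suc zero ∷ _ ∷ _ ∷ []) (_ ∷ (_ ∷ _ ∷ 1≢1 ∷ []) ∷ _)      _ _ = 1≢1 refl
pairing-unbalanced m (_ ∷ _ ∷ zero ∷ [])     ((_ ∷ _ ∷ 0≢0 ∷ _) ∷ _)           _ _ = 0≢0 refl
pairing-unbalanced m (_ ∷ _ ∷ suc zero ∷ []) (_ ∷ _ ∷ _ ∷ (1≢1 ∷ []) ∷ _)      _ _ = 1≢1 refl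
pairing-unbalanced m (z₁@(suc (suc _)) ∷ z₂ ∷ z₃@(suc (suc _)) ∷ [])
                   (_ ∷ (z₁≢z₂ ∷ z₁≢z₃ ∷ _) ∷ (z₂≢z₃ ∷ _) ∷ _) _ balanced
  with balanced-plus-a-b-plus _ _ balanced
... | z₁z₂ , z₂z₃ =
  z₁≢z₃ (pairing-matching _ z₂ z₁ z₃ (≢-sym z₁≢z₂) z₂≢z₃ (trans (symm (pairing _) z₂ z₁) z₁z₂) z₂z₃)
pairing-unbalanced m (_ ∷ _ ∷ _ ∷ _ ∷ _) _ (s≤s (s≤s (s≤s (s≤s ())))) _

sharpness : (n : ℕ) → 6 ≤ n →
  ∃[ f ] (edgeCount f minus ⊓ edgeCount f plus ≡ ⌈ suc n /2⌉ ∸ 1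
    × ∃[ a ] ∃[ b ] (a ≢ b ×
        ((ms : List (Fin n)) → Unique (pathVerts a ms b) → pathLength ms ≤ 4 →
          walkValue f (pathVerts a ms b) ≢ 0ℤ)))
sharpness (suc (suc m)) (s≤s (s≤s 4≤m)) =
  pairing (2 + m) , edgeCount-pairing-minimum m (≤-trans (s≤s z≤n) 4≤m) ,
  zero , suc zero , (λ ()) , pairing-unbalanced m

-- Opened only here: with the constructor + in scope, m + n no longer parses.
open import Data.Sign using (-; +)

theorem6p1 :
  ((n : ℕ) → 6 ≤ n → (f : Colouring n) →
    ⌈ suc n /2⌉ ≤ edgeCount f - ⊓ edgeCount f + →
    (x y : Fin n) → x ≢ y →
    ∃[ ms ] (Unique (pathVerts x ms y) × pathLength ms ≤ 4
             × walkValue f (pathVerts x ms y) ≡ 0ℤ))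
  ×
  ((n : ℕ) → 6 ≤ n →
    ∃[ f ] (edgeCount f - ⊓ edgeCount f + ≡ ⌈ suc n /2⌉ ∸ 1
      × ∃[ a ] ∃[ b ] (a ≢ b ×
          ((ms : List (Fin n)) → Unique (pathVerts a ms b) → pathLength ms ≤ 4 →
            walkValue f (pathVerts a ms b) ≢ 0ℤ))))
theorem6p1 = balanced-path-exists , sharpness
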